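{- Let $\varphi$ be a quantifier-free $\mathcal{T}$-formula and $\boldsymbol{\alpha}$ a finite set of atoms containing all atoms of $\varphi$. Let $\{C_1,\ldots,C_K\}$ be a set of $\mathcal{T}$-lemmas on $\boldsymbol{\alpha}$ which rules out $P_{\boldsymbol{\alpha}}(\neg\varphi)$, and let $\mathrm{Text}(\varphi)=\varphi\vee\neg\big(\bigwedge_{l=1}^K C_l\big)$. Then (i) $\mathrm{Text}(\varphi)\equiv_{\mathcal{T}}\varphi$; (ii) $\varphi\models_p\mathrm{Text}(\varphi)$; (iii) $\mathrm{Text}(\varphi)$ is $\mathcal{T}$-extended with respect to $\boldsymbol{\alpha}$.
   Context: $\mathcal{T}$-formulas are quantifier-free formulas built by Boolean connectives from $\mathcal{T}$-atoms and Boolean atoms. The Boolean abstraction maps each atom bijectively to a Boolean variable; $\varphi\models_p\psi$ means the Boolean abstraction of $\varphi$ entails that of $\psi$ propositionally. $\equiv_{\mathcal{T}}$ is equivalence modulo $\mathcal{T}$. A $\mathcal{T}$-lemma is a $\mathcal{T}$-valid clause. A total truth assignment on $\boldsymbol{\alpha}$ is a conjunction containing, for each $a\in\boldsymbol{\alpha}$, exactly one of $a,\neg a$. $P_{\boldsymbol{\alpha}}(\psi)$ is the set of $\mathcal{T}$-unsatisfiable total truth assignments $\rho$ on $\boldsymbol{\alpha}$ with $\rho\models_p\psi$. A set of $\mathcal{T}$-lemmas $\{C_1,\dots,C_K\}$ rules out a set $\{\rho_1,\dots,\rho_M\}$ of $\mathcal{T}$-unsatisfiable total truth assignments iff for every $\rho_j$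 there is some $C_l$ with $\rho_j\models_p\neg C_l$. A formula $\psi$ is $\mathcal{T}$-extended with respect to $\boldsymbol{\alpha}$ iff $P_{\boldsymbol{\alpha}}(\neg\psi)=\emptyset$. -}

module Defs where

open import Data.Bool using (Bool; true; false; not; _∧_; _∨_)
open import Data.List using (List; []; _∷_; map; foldr)
open import Data.List.Membership.Propositional using (_∈_)
open import Data.List.Relation.Unary.All using (All)
open import Data.Product using (∃; _×_)
open import Relation.Binary.PropositionalEquality using (_≡_)

-- The Boolean abstraction maps each atom bijectively to a Boolean variable, so we
-- identify atoms with their propositional variables.
data Formula (Atom : Set) : Set where
  atom : Atom → Formula Atom
  ⊤f ⊥f : Formula Atom
  ¬f_ : Formula Atom → Formula Atom
  _∧f_ _∨f_ : Formula Atom → Formula Atom → Formula Atom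

infix  6 ¬f_

infixr 5 _∧f_
infixr 4 _∨f_

module _ {Atom : Set} where

  atoms : Formula Atom → List Atom
  atoms (atom a) = a ∷ []
  atoms ⊤f = []
  atoms ⊥f = []
  atoms (¬f φ) = atoms φ
  atoms (φ ∧f ψ) = atoms φ Data.List.++ atoms ψ
  atoms (φ ∨f ψ) = atoms φ Data.List.++ atoms ψ

  eval : (Atom → Bool) → Formula Atom → Bool
  eval v (atom a) = v a
  eval v ⊤f = true
  eval v ⊥f = false
  eval v (¬f φ) = not (eval v φ)
  eval v (φ ∧f ψ) = eval v φ ∧ eval v ψ
  eval v (φ ∨f ψ) = eval v φ ∨ eval v ψ

  ⋀ : List (Formula Atom) → Formula Atom
  ⋀ = foldr _∧f_ ⊤f

  ⋁ : List (Formula Atom) → Formula Atom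
  ⋁ = foldr _∨f_ ⊥f

  lit : Atom → Bool → Formula Atom
  lit a true  = atom a
  lit a false = ¬f atom a

  record Literal : Set where
    constructor mkLit
    field
      var      : Atom
      polarity : Bool

  Clause : Set
  Clause = List Literal

  clause→formula : Clause → Formula Atom
  clause→formula C = ⋁ (map (λ l → lit (Literal.var l) (Literal.polarity l)) C)

  clauseAtoms : Clause → List Atom
  clauseAtoms = map Literal.var

  infix 2 _⊨p_
  _⊨p_ : Formula Atom → Formula Atom → Set
  φ ⊨p ψ = ∀ (v : Atom → Bool) → eval v φ ≡ true → eval v ψ ≡ true

  totalAssignment : List Atom → (Atom → Bool) → Formula Atom
  totalAssignment α σ = ⋀ (map (λ a → lit a (σ a)) α)

-- A theory T: a class of models, each interpreting every atom as a truth value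
-- (T-atoms are interpreted according to T; Boolean atoms freely).
record Theory (Atom : Set) : Set₁ where
  field
    Model  : Set
    interp : Model → Atom → Bool

module _ {Atom : Set} (T : Theory Atom) where
  open Theory T

  T-valid : Formula Atom → Set
  T-valid φ = ∀ (M : Model) → eval (interp M) φ ≡ true

  T-unsat : Formula Atom → Set
  T-unsat φ = ∀ (M : Model) → eval (interp M) φ ≡ false

  infix 2 _≡T_
  _≡T_ : Formula Atom → Formula Atom → Set
  φ ≡T ψ = ∀ (M : Model) → eval (interp M) φ ≡ eval (interp M) ψ

  T-lemmaOn : List Atom → Clause → Set
  T-lemmaOn α C = T-valid (clause→formula C) × All (_∈ α) (clauseAtoms C)

  InP : List Atom → Formula Atom → (Atom → Bool) → Set
  InP α ψ σ = T-unsat (totalAssignment α σ) × (totalAssignment α σ ⊨p ψ)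

  RulesOut : List Clause → List Atom → Formula Atom → Set
  RulesOut Cs α ψ = ∀ (σ : Atom → Bool) → InP α ψ σ →
    ∃ λ C → C ∈ Cs × (totalAssignment α σ ⊨p ¬f clause→formula C)

  T-extended : List Atom → Formula Atom → Set
  T-extended α ψ = ∀ (σ : Atom → Bool) → InP α (¬f ψ) σ → Data.Empty.⊥
    where import Data.Empty

Text : {Atom : Set} → List (Clause {Atom}) → Formula Atom → Formula Atom
Text Cs φ = φ ∨f ¬f ⋀ (map clause→formula Cs)

-- A T-lemma is true in every model of T, so the disjunct ¬(C₁ ∧ … ∧ C_K) is
-- T-inconsistent and adding it changes nothing modulo T, while φ ⊨p Text(φ)
-- is propositionally trivial. For T-extendedness, a T-unsatisfiable total
-- assignment ρ with ρ ⊨p ¬Text(φ) entails both ¬φ and every C_l; the first makes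
-- ρ a member of P_α(¬φ), so some C_l is falsified by ρ. Since ρ is satisfied by
-- the valuation that defines it, that valuation would make C_l both true and false.
module Submission where

open import Defs
open import Data.Bool using (Bool; true; false; not; _∨_)
open import Data.Bool.Properties using (∨-identityʳ; ∨-conicalˡ; ∨-conicalʳ; ∧-conicalˡ; ∧-conicalʳ; not-injective; not-involutive; not-¬)
open import Data.List using (List; []; _∷_; map)
open import Data.List.Relation.Unary.All as All using (All; []; _∷_)
open import Data.List.Relation.Unary.All.Properties using (map⁺; map⁻)
open import Data.List.Membership.Propositional using (_∈_)
open import Data.Product using (_×_; _,_; proj₁)
open import Relation.Binary.PropositionalEquality using (_≡_; refl; sym; trans; cong; module ≡-Reasoning)

module _ {Atom : Set} where

  ⋀-true⁺ : ∀ {v : Atom → Bool} {Fs : List (Formula Atom)}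
    → All (λ F → eval v F ≡ true) Fs → eval v (⋀ Fs) ≡ true
  ⋀-true⁺ []       = refl
  ⋀-true⁺ (p ∷ ps) rewrite p = ⋀-true⁺ ps

  ⋀-true⁻ : ∀ {v : Atom → Bool} (Fs : List (Formula Atom))
    → eval v (⋀ Fs) ≡ true → All (λ F → eval v F ≡ true) Fs
  ⋀-true⁻ []       _ = []
  ⋀-true⁻ (F ∷ Fs) e = ∧-conicalˡ _ _ e ∷ ⋀-true⁻ Fs (∧-conicalʳ _ _ e)

  lit-true : ∀ {v : Atom → Bool} {a : Atom} {b : Bool} → v a ≡ b → eval v (lit a b) ≡ true
  lit-true {b = true}  e = e
  lit-true {b = false} e = cong not e

  totalAssignment-self : (σ : Atom → Bool) (α : List Atom) → eval σ (totalAssignment α σ) ≡ true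
  totalAssignment-self σ α = ⋀-true⁺ (map⁺ (All.universal (λ a → lit-true {v = σ} {a} refl) α))

  ⊨p-∨ˡ : {φ ψ : Formula Atom} → φ ⊨p φ ∨f ψ
  ⊨p-∨ˡ {ψ = ψ} v e = cong (_∨ eval v ψ) e

  ¬∨-⊨p-¬ˡ : {φ ψ : Formula Atom} → ¬f (φ ∨f ψ) ⊨p ¬f φ
  ¬∨-⊨p-¬ˡ v e = cong not (∨-conicalˡ _ _ (not-injective e))

  ¬∨-⊨p-¬ʳ : {φ ψ : Formula Atom} → ¬f (φ ∨f ψ) ⊨p ¬f ψ
  ¬∨-⊨p-¬ʳ v e = cong not (∨-conicalʳ _ _ (not-injective e))

  ¬¬-⊨p : {φ : Formula Atom} → ¬f ¬f φ ⊨p φ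
  ¬¬-⊨p v e = trans (sym (not-involutive _)) e

  module _ (T : Theory Atom) where
    open Theory T

    ⋀-T-valid : {Fs : List (Formula Atom)} → All (T-valid T) Fs → T-valid T (⋀ Fs)
    ⋀-T-valid ps M = ⋀-true⁺ (All.map (λ p → p M) ps)

    ∨¬-T-valid-≡T : {φ χ : Formula Atom} → T-valid T χ → _≡T_ T (φ ∨f ¬f χ) φ
    ∨¬-T-valid-≡T {φ} {χ} valid M = begin
      eval (interp M) φ ∨ not (eval (interp M) χ)  ≡⟨ cong (λ b → eval (interp M) φ ∨ not b) (valid M) ⟩
      eval (interp M) φ ∨ false                    ≡⟨ ∨-identityʳ _ ⟩
      eval (interp M) φ                            ∎
      where open ≡-Reasoning

    InP-mono : {α : List Atom} {ψ ψ′ : Formula Atom} {σ : Atom → Bool}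
      → ψ ⊨p ψ′ → InP T α ψ σ → InP T α ψ′ σ
    InP-mono ψ⊨ψ′ (unsat , ρ⊨ψ) = unsat , λ v e → ψ⊨ψ′ v (ρ⊨ψ v e)

theorem4p12 : {Atom : Set} (T : Theory Atom) (φ : Formula Atom) (α : List Atom)
    → All (_∈ α) (atoms φ)
    → (Cs : List (Clause {Atom}))
    → All (T-lemmaOn T α) Cs
    → RulesOut T Cs α (¬f φ)
    → (_≡T_ T (Text Cs φ) φ) × (φ ⊨p Text Cs φ) × T-extended T α (Text Cs φ)
theorem4p12 {Atom} T φ α _ Cs lemmas rulesOut =
  ∨¬-T-valid-≡T T {φ} {⋀Cs} ⋀Cs-valid , ⊨p-∨ˡ {φ = φ} {¬f ⋀Cs} , extended
  where
  ⋀Cs : Formula Atom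
  ⋀Cs = ⋀ (map clause→formula Cs)

  ⋀Cs-valid : T-valid T ⋀Cs
  ⋀Cs-valid = ⋀-T-valid T (map⁺ (All.map proj₁ lemmas))

  extended : T-extended T α (Text Cs φ)
  extended σ ρ∈P@(_ , ρ⊨¬Text)
    with rulesOut σ (InP-mono T {α} {¬f Text Cs φ} {¬f φ} (¬∨-⊨p-¬ˡ {φ = φ} {¬f ⋀Cs}) ρ∈P)
  ... | C , C∈Cs , ρ⊨¬C = not-¬ C-true (not-injective (ρ⊨¬C σ ρ-self))
    where
    ρ-self : eval σ (totalAssignment α σ) ≡ true
    ρ-self = totalAssignment-self σ α

    ⋀Cs-true : eval σ ⋀Cs ≡ true
    ⋀Cs-true = ¬¬-⊨p {φ = ⋀Cs} σ (¬∨-⊨p-¬ʳ {φ = φ} {¬f ⋀Cs} σ (ρ⊨¬Text σ ρ-self))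

    C-true : eval σ (clause→formula C) ≡ true
    C-true = All.lookup (map⁻ (⋀-true⁻ (map clause→formula Cs) ⋀Cs-true)) C∈Cs
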